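{- Let $\varphi_i:S_i\Rightarrow T_i$ be sijections for $i=1,2,3$. Then $(\varphi_1\times\varphi_2)\times\varphi_3=\varphi_1\times(\varphi_2\times\varphi_3)$ as sijections $S_1\times S_2\times S_3\Rightarrow T_1\times T_2\times T_3$, where $((a,b),c)$ and $(a,(b,c))$ are identified with $(a,b,c)$.
   Context: Signed sets are pairs $S=(S^+,S^-)$ of disjoint finite sets with support $|S|=S^+\sqcup S^-$. The Cartesian product is $S\times T=(S^+\times T^+\sqcup S^-\times T^-,\ S^+\times T^-\sqcup S^-\times T^+)$. A sijection $\varphi:S\Rightarrow T$ is an involution on $|S|\sqcup|T|$ with $\varphi(S^+\sqcup T^-)=S^-\sqcup T^+$. For sijections $\varphi:S\Rightarrow T$ and $\varphi':S'\Rightarrow T'$, the sijection $\varphi\times\varphi':S\times S'\Rightarrow T\times T'$ is defined as follows. - On $(s,s')\in|S|\times|S'|$ it gives: - $(\varphi(s),s')$ if $\varphi(s)\in|S|$; - $(s,\varphi'(s'))$ if $\varphi(s)\in|T|$ and $\varphi'(s')\in|S'|$; - $(\varphi(s),\varphi'(s'))$ if $\varphi(s)\in|T|$ and $\varphi'(s')\in|T'|$. - On $(t,t')\in|T|\times|T'|$ it gives: - $(\varphi(t),t')$ if $\varphi(t)\in|T|$; - $(t,\varphi'(t'))$ if $\varphi(t)\in|S|$ and $\varphi'(t')\in|T'|$; - $(\varphi(t),\varphi'(t'))$ otherwise. -}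

module Defs where

open import Data.Nat using (ℕ; _*_)
open import Data.Fin using (Fin)
open import Data.Fin.Properties using (*↔×)
open import Data.Bool using (Bool; true; false; not; _xor_)
open import Data.Sum using (_⊎_; inj₁; inj₂)
open import Data.Product using (_×_; _,_; Σ)
open import Function.Bundles using (_↔_)
open import Function.Construct.Composition using (_↔-∘_)
open import Function.Construct.Symmetry using (↔-sym)
open import Data.Product.Function.NonDependent.Propositional using (_×-↔_)
open import Relation.Binary.PropositionalEquality using (_≡_)

-- A (finite) signed set: a finite support |S| together with a sign on each
-- element.  S⁺ = { x | sign x ≡ true },  S⁻ = { x | sign x ≡ false };
-- these are disjoint and partition |S|.
record SignedSet : Set₁ where
  field
    Carrier : Set
    sign    : Carrier → Bool
    size    : ℕ
    finite  : Carrier ↔ Fin size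
open SignedSet public

∣_∣ : SignedSet → Set
∣ S ∣ = Carrier S

-- Cartesian product of signed sets: support |S|×|T|, (s,t) positive
-- iff s,t have the same sign, i.e.
--   (S×T)⁺ = S⁺×T⁺ ⊔ S⁻×T⁻ ,  (S×T)⁻ = S⁺×T⁻ ⊔ S⁻×T⁺.
_×ˢ_ : SignedSet → SignedSet → SignedSet
S ×ˢ T = record
  { Carrier = Carrier S × Carrier T
  ; sign    = λ { (s , t) → not (sign S s xor sign T t) }
  ; size    = size S * size T
  ; finite  = ↔-sym *↔× ↔-∘ (finite S ×-↔ finite T)
  }

-- For x ∈ |S| ⊔ |T|: true iff x ∈ S⁺ ⊔ T⁻ ; false iff x ∈ S⁻ ⊔ T⁺.
side : (S T : SignedSet) → ∣ S ∣ ⊎ ∣ T ∣ → Bool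
side S T (inj₁ s) = sign S s
side S T (inj₂ t) = not (sign T t)

-- A sijection φ : S ⇒ T : an involution on |S| ⊔ |T| with
-- φ(S⁺ ⊔ T⁻) = S⁻ ⊔ T⁺.
record Sijection (S T : SignedSet) : Set where
  field
    fun        : ∣ S ∣ ⊎ ∣ T ∣ → ∣ S ∣ ⊎ ∣ T ∣
    involutive : ∀ x → fun (fun x) ≡ x
    image⊆     : ∀ x → side S T x ≡ true → side S T (fun x) ≡ false
    image⊇     : ∀ y → side S T y ≡ false →
                 Σ (∣ S ∣ ⊎ ∣ T ∣) (λ x → (side S T x ≡ true) × (fun x ≡ y))
open Sijection public

-- The underlying map of φ × φ' : S × S' ⇒ T × T', exactly as in the paper.
-- It only depends on the underlying maps of φ and φ', so it is defined on
-- arbitrary maps φ : |S|⊔|T| → |S|⊔|T|, φ' : |S'|⊔|T'| → |S'|⊔|T'|.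
-- (That the result is again a sijection when φ, φ' are is a separate fact.)
module _ {S T S′ T′ : SignedSet}
         (φ : ∣ S ∣ ⊎ ∣ T ∣ → ∣ S ∣ ⊎ ∣ T ∣)
         (φ′ : ∣ S′ ∣ ⊎ ∣ T′ ∣ → ∣ S′ ∣ ⊎ ∣ T′ ∣) where

  private
    caseS : ∣ S ∣ → ∣ S′ ∣ → ∣ S ∣ ⊎ ∣ T ∣ → ∣ S′ ∣ ⊎ ∣ T′ ∣
          → (∣ S ∣ × ∣ S′ ∣) ⊎ (∣ T ∣ × ∣ T′ ∣)
    caseS s s′ (inj₁ u) _          = inj₁ (u , s′)
    caseS s s′ (inj₂ _) (inj₁ u′)  = inj₁ (s , u′)
    caseS s s′ (inj₂ v) (inj₂ v′)  = inj₂ (v , v′)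

    caseT : ∣ T ∣ → ∣ T′ ∣ → ∣ S ∣ ⊎ ∣ T ∣ → ∣ S′ ∣ ⊎ ∣ T′ ∣
          → (∣ S ∣ × ∣ S′ ∣) ⊎ (∣ T ∣ × ∣ T′ ∣)
    caseT t t′ (inj₂ v) _          = inj₂ (v , t′)
    caseT t t′ (inj₁ _) (inj₂ v′)  = inj₂ (t , v′)
    caseT t t′ (inj₁ u) (inj₁ u′)  = inj₁ (u , u′)

  prodFun : ∣ S ×ˢ S′ ∣ ⊎ ∣ T ×ˢ T′ ∣ → ∣ S ×ˢ S′ ∣ ⊎ ∣ T ×ˢ T′ ∣
  prodFun (inj₁ (s , s′)) = caseS s s′ (φ (inj₁ s)) (φ′ (inj₁ s′))
  prodFun (inj₂ (t , t′)) = caseT t t′ (φ (inj₂ t)) (φ′ (inj₂ t′))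

assoc⊎ : {A B C D E F : Set} →
         ((A × B) × C) ⊎ ((D × E) × F) → (A × (B × C)) ⊎ (D × (E × F))
assoc⊎ (inj₁ ((a , b) , c)) = inj₁ (a , (b , c))
assoc⊎ (inj₂ ((d , e) , f)) = inj₂ (d , (e , f))

{-# OPTIONS --safe #-}
module Submission where

open import Defs
open import Relation.Binary.PropositionalEquality using (_≡_; refl)
open import Data.Sum using (_⊎_; inj₁; inj₂)
open import Data.Product using (_,_)

-- On a point (a, b, c) of either side, both bracketings apply the first factor map
-- that keeps its coordinate on the same side (|S| or |T|), and move all three coordinates across
-- if there is none; so the products agree pointwise, for arbitrary maps.

prodFun-assoc : {S₁ T₁ S₂ T₂ S₃ T₃ : SignedSet}
  (φ₁ : ∣ S₁ ∣ ⊎ ∣ T₁ ∣ → ∣ S₁ ∣ ⊎ ∣ T₁ ∣)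
  (φ₂ : ∣ S₂ ∣ ⊎ ∣ T₂ ∣ → ∣ S₂ ∣ ⊎ ∣ T₂ ∣)
  (φ₃ : ∣ S₃ ∣ ⊎ ∣ T₃ ∣ → ∣ S₃ ∣ ⊎ ∣ T₃ ∣) →
  ∀ x → assoc⊎ (prodFun {S₁ ×ˢ S₂} {T₁ ×ˢ T₂} {S₃} {T₃} (prodFun {S₁} {T₁} {S₂} {T₂} φ₁ φ₂) φ₃ x)
      ≡ prodFun {S₁} {T₁} {S₂ ×ˢ S₃} {T₂ ×ˢ T₃} φ₁ (prodFun {S₂} {T₂} {S₃} {T₃} φ₂ φ₃) (assoc⊎ x)
prodFun-assoc φ₁ φ₂ φ₃ (inj₁ ((a , b) , c)) with φ₁ (inj₁ a) | φ₂ (inj₁ b) | φ₃ (inj₁ c)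
... | inj₁ _ | _      | _      = refl
... | inj₂ _ | inj₁ _ | _      = refl
... | inj₂ _ | inj₂ _ | inj₁ _ = refl
... | inj₂ _ | inj₂ _ | inj₂ _ = refl
prodFun-assoc φ₁ φ₂ φ₃ (inj₂ ((a , b) , c)) with φ₁ (inj₂ a) | φ₂ (inj₂ b) | φ₃ (inj₂ c)
... | inj₂ _ | _      | _      = refl
... | inj₁ _ | inj₂ _ | _      = refl
... | inj₁ _ | inj₁ _ | inj₂ _ = refl
... | inj₁ _ | inj₁ _ | inj₁ _ = refl

mainTheorem14 : {S₁ T₁ S₂ T₂ S₃ T₃ : SignedSet}
    (φ₁ : Sijection S₁ T₁) (φ₂ : Sijection S₂ T₂) (φ₃ : Sijection S₃ T₃) →
    ∀ x → assoc⊎ (prodFun {S₁ ×ˢ S₂} {T₁ ×ˢ T₂} {S₃} {T₃} (prodFun {S₁} {T₁} {S₂} {T₂} (fun φ₁) (fun φ₂)) (fun φ₃) x)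
          ≡ prodFun {S₁} {T₁} {S₂ ×ˢ S₃} {T₂ ×ˢ T₃} (fun φ₁) (prodFun {S₂} {T₂} {S₃} {T₃} (fun φ₂) (fun φ₃)) (assoc⊎ x)
mainTheorem14 φ₁ φ₂ φ₃ = prodFun-assoc (fun φ₁) (fun φ₂) (fun φ₃)
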